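{- For a positive integer $n$, let $\overline{\mathcal{M}}_e(n)$ (resp. $\overline{\mathcal{M}}_o(n)$) be the number of overpartitions of $n$ with an even (resp. odd) number of missing integers. Then for every positive integer $n$, \[ \overline{\mathcal{M}}_e(n)-\overline{\mathcal{M}}_o(n)\equiv \begin{cases} 0 \pmod 4, & \text{if } n \text{ is not a square},\\ 2 \pmod 4, & \text{if } n \text{ is a square}. \end{cases} \]
   Context: An overpartition of $n$ is a partition of $n$ in which the first occurrence of any integer may be overlined. The largest part is the largest integer occurring (overlined or not). A missing integer is a positive integer less than the largest part that occurs neither overlined nor non-overlined. -}

module Defs where

open import Data.Nat using (ℕ; zero; suc; _+_; _*_; _<_; _≤_; _⊔_; _≟_; _<?_; _≤?_)
open import Data.Bool using (Bool; true; false)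
open import Data.Bool.Properties using () renaming (_≟_ to _≟ᵇ_)
open import Data.Product using (Σ; _×_; _,_; proj₁; proj₂)
open import Data.Nat.DivMod using (_%_)
open import Data.Nat.ListAction using (sum)
open import Data.Sum using (_⊎_)
open import Data.List using (List; []; _∷_; map; length; filter; concatMap; upTo; foldr)
open import Data.List.Relation.Unary.All using (All; all?)
open import Data.List.Relation.Unary.Linked using (Linked; linked?)
open import Data.List.Membership.DecPropositional _≟_ using (_∈_; _∈?_)
open import Relation.Binary.PropositionalEquality using (_≡_)
open import Relation.Nullary using (Dec; ¬_)
open import Relation.Nullary.Decidable using (_×-dec_; _⊎-dec_; ¬?)

-- A part of an overpartition: its size and whether it is overlined (true = overlined).
Part : Set
Part = ℕ × Bool

-- Canonical listing of an overpartition: parts in nonincreasing order, and among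
-- equal parts the (unique, optional) overlined copy comes first.  This forces at most one overlined copy per size,
-- i.e. only the first occurrence of an integer may be overlined.
Adjacent : Part → Part → Set
Adjacent p q = (proj₁ q < proj₁ p) ⊎ ((proj₁ q ≡ proj₁ p) × (proj₂ q ≡ false))

adjacent? : ∀ p q → Dec (Adjacent p q)
adjacent? p q = (proj₁ q <? proj₁ p) ⊎-dec ((proj₁ q ≟ proj₁ p) ×-dec (proj₂ q ≟ᵇ false))

Positive : Part → Set
Positive p = 1 ≤ proj₁ p

IsOverpartition : ℕ → List Part → Set
IsOverpartition n xs = All Positive xs × Linked Adjacent xs × (sum (map proj₁ xs) ≡ n)

isOverpartition? : ∀ n xs → Dec (IsOverpartition n xs)
isOverpartition? n xs =
  all? (λ p → 1 ≤? proj₁ p) xs ×-dec (linked? adjacent? xs ×-dec (sum (map proj₁ xs) ≟ n))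

listsOfLength : ℕ → ℕ → List (List Part)
listsOfLength n zero = [] ∷ []
listsOfLength n (suc m) =
  concatMap (λ k → concatMap (λ b → map ((suc k , b) ∷_) (listsOfLength n m)) (true ∷ false ∷ []))
            (upTo n)

-- All candidate lists of length ≤ n with parts in {1..n}; every overpartition of n
-- is among them (it has at most n parts, each at most n), each exactly once.
candidates : ℕ → List (List Part)
candidates n = concatMap (listsOfLength n) (upTo (suc n))

overpartitions : ℕ → List (List Part)
overpartitions n = filter (isOverpartition? n) (candidates n)

largestPart : List Part → ℕ
largestPart xs = foldr _⊔_ 0 (map proj₁ xs)

Missing : List Part → ℕ → Set
Missing xs k = 1 ≤ k × k < largestPart xs × ¬ (k ∈ map proj₁ xs)

missing? : ∀ xs k → Dec (Missing xs k)
missing? xs k = (1 ≤? k) ×-dec ((k <? largestPart xs) ×-dec ¬? (k ∈? map proj₁ xs))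

-- Number of missing integers (all candidates are < largest part, so upTo suffices).
numMissing : List Part → ℕ
numMissing xs = length (filter (missing? xs) (upTo (largestPart xs)))

Me : ℕ → ℕ
Me n = length (filter (λ xs → numMissing xs % 2 ≟ 0) (overpartitions n))

Mo : ℕ → ℕ
Mo n = length (filter (λ xs → numMissing xs % 2 ≟ 1) (overpartitions n))

IsSquare : ℕ → Set
IsSquare n = Σ ℕ (λ m → m * m ≡ n)

-- Overlining the largest part or not is a fixed-point-free involution that preserves the
-- missing integers.  Hence M̄ₒ(n) is even, and p̄(n) = M̄ₑ(n) + M̄ₒ(n) is twice the number u of
-- overpartitions of n whose largest part is not overlined, so M̄ₑ(n) − M̄ₒ(n) ≡ p̄(n) = 2u (mod 4).
-- Modulo 2, the overpartitions of s into m + 1 parts with non-overlined largest part j reduce to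
-- the single one j + ⋯ + j: deleting the largest part leaves an overpartition of s − j into m
-- parts, whose next part, if smaller than j, can be overlined or not (the two choices cancel),
-- and, if equal to j, must not be overlined.  So u ≡ #{(a , b) : a b = n} (mod 2), and pairing
-- (a , b) with (b , a) leaves only the diagonal: u is odd exactly when n is a square.

module Submission where

open import Defs
open import Data.Nat using (ℕ; _≤_)
open import Data.Integer using (+_; _-_)
open import Data.Integer.Divisibility using (_∣_)
open import Data.Product using (_×_)
open import Relation.Nullary using (¬_)

open import Data.Bool using (Bool; true; false)
open import Data.Integer using (ℤ)
import Data.Integer as ℤ
import Data.Integer.Divisibility as ℤ∣
import Data.Integer.Properties as ℤ
open import Data.Integer.Tactic.RingSolver using (solve-∀)
open import Data.List using (List; []; _∷_; map; length; filter; concatMap; applyUpTo; _++_)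
open import Data.List.Properties using (map-++; map-cong; map-∘)
open import Data.List.Relation.Unary.All using ([]; _∷_)
open import Data.List.Relation.Unary.Linked using ([-]; _∷_)
open import Data.Nat using (zero; suc; _+_; _*_; _<_; _/_; _%_; z≤n; s≤s; _≟_; _<?_)
open import Data.Nat.DivMod using (%-distribˡ-+; m*n%n≡0; m≡m%n+[m/n]*n; m<n⇒m%n≡m; m%n<n)
import Data.Nat.Divisibility as ℕ∣
open import Data.Nat.ListAction using (sum)
open import Data.Nat.ListAction.Properties using (sum-++)
open import Data.Nat.Properties
open import Algebra.Properties.CommutativeSemigroup +-commutativeSemigroup using (interchange)
open import Data.Product using (∃; _,_; proj₁; proj₂; map₁)
open import Data.Sum using (_⊎_; inj₁; inj₂)
open import Function using (_∘_; id)
open import Function.Bundles using (_⇔_; mk⇔; Equivalence)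
open import Level using (0ℓ)
open import Relation.Binary.Bundles using (Setoid)
open import Relation.Binary.Definitions using (tri<; tri≈; tri>)
open import Relation.Binary.PropositionalEquality
import Relation.Binary.Reasoning.Setoid as SetoidReasoning
open import Relation.Binary.Structures using (IsEquivalence)
open import Relation.Nullary using (Dec; _because_; yes; no; contradiction)
open import Relation.Nullary.Decidable using (_×-dec_)

sumBelow : ℕ → (ℕ → ℕ) → ℕ
sumBelow zero    f = 0
sumBelow (suc n) f = f 0 + sumBelow n (f ∘ suc)

sumBelow-cong : ∀ n {f g : ℕ → ℕ} → (∀ k → f k ≡ g k) → sumBelow n f ≡ sumBelow n g
sumBelow-cong zero    f≗g = refl
sumBelow-cong (suc n) f≗g = cong₂ _+_ (f≗g 0) (sumBelow-cong n (f≗g ∘ suc))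

sumBelow-+ : ∀ n (f g : ℕ → ℕ) → sumBelow n (λ k → f k + g k) ≡ sumBelow n f + sumBelow n g
sumBelow-+ zero    f g = refl
sumBelow-+ (suc n) f g =
  trans (cong (_+_ (f 0 + g 0)) (sumBelow-+ n (f ∘ suc) (g ∘ suc)))
        (interchange (f 0) (g 0) _ _)

sum-map-cong : ∀ {A : Set} {f g : A → ℕ} → (∀ x → f x ≡ g x) → ∀ xs → sum (map f xs) ≡ sum (map g xs)
sum-map-cong f≗g xs = cong sum (map-cong f≗g xs)

sum-map-zero : ∀ {A : Set} {f : A → ℕ} → (∀ x → f x ≡ 0) → ∀ xs → sum (map f xs) ≡ 0
sum-map-zero f≗0 []       = refl
sum-map-zero f≗0 (x ∷ xs) = cong₂ _+_ (f≗0 x) (sum-map-zero f≗0 xs)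

sum-map-+ : ∀ {A : Set} (f g : A → ℕ) xs →
  sum (map (λ x → f x + g x) xs) ≡ sum (map f xs) + sum (map g xs)
sum-map-+ f g []       = refl
sum-map-+ f g (x ∷ xs) =
  trans (cong (_+_ (f x + g x)) (sum-map-+ f g xs))
        (interchange (f x) (g x) _ _)

sum-map-concatMap : ∀ {A B : Set} (f : B → ℕ) (g : A → List B) xs →
  sum (map f (concatMap g xs)) ≡ sum (map (λ x → sum (map f (g x))) xs)
sum-map-concatMap f g []       = refl
sum-map-concatMap f g (x ∷ xs) = begin
  sum (map f (g x ++ concatMap g xs))         ≡⟨ cong sum (map-++ f (g x) _) ⟩
  sum (map f (g x) ++ map f (concatMap g xs)) ≡⟨ sum-++ (map f (g x)) _ ⟩
  sum (map f (g x)) + sum (map f (concatMap g xs)) ≡⟨ cong (_+_ (sum (map f (g x)))) (sum-map-concatMap f g xs) ⟩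
  sum (map f (g x)) + sum (map (λ x → sum (map f (g x))) xs) ∎
  where open ≡-Reasoning

sum-map-applyUpTo : ∀ {A : Set} (f : A → ℕ) (g : ℕ → A) n →
  sum (map f (applyUpTo g n)) ≡ sumBelow n (f ∘ g)
sum-map-applyUpTo f g zero    = refl
sum-map-applyUpTo f g (suc n) = cong (_+_ (f (g 0))) (sum-map-applyUpTo f (g ∘ suc) n)

infix 4 _≡₂_

record _≡₂_ (m n : ℕ) : Set where
  constructor mod₂
  field ≡-mod₂ : m % 2 ≡ n % 2

≡₂-isEquivalence : IsEquivalence _≡₂_
≡₂-isEquivalence = record
  { refl  = mod₂ refl
  ; sym   = λ (mod₂ m≡n) → mod₂ (sym m≡n)
  ; trans = λ (mod₂ m≡n) (mod₂ n≡o) → mod₂ (trans m≡n n≡o)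
  }

≡₂-setoid : Setoid 0ℓ 0ℓ
≡₂-setoid = record { isEquivalence = ≡₂-isEquivalence }

open IsEquivalence ≡₂-isEquivalence
  using () renaming (refl to ≡₂-refl; trans to ≡₂-trans)

≡⇒≡₂ : ∀ {m n} → m ≡ n → m ≡₂ n
≡⇒≡₂ m≡n = mod₂ (cong (_% 2) m≡n)

≡₂-+ : ∀ {a b c d} → a ≡₂ b → c ≡₂ d → a + c ≡₂ b + d
≡₂-+ {a} {b} {c} {d} (mod₂ a≡₂b) (mod₂ c≡₂d) = mod₂ (begin
  (a + c) % 2           ≡⟨ %-distribˡ-+ a c 2 ⟩
  (a % 2 + c % 2) % 2   ≡⟨ cong₂ (λ x y → (x + y) % 2) a≡₂b c≡₂d ⟩
  (b % 2 + d % 2) % 2   ≡⟨ %-distribˡ-+ b d 2 ⟨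
  (b + d) % 2           ∎)
  where open ≡-Reasoning

m+m≡₂0 : ∀ m → m + m ≡₂ 0
m+m≡₂0 m = mod₂ (trans (cong (_% 2) m+m≡m*2) (m*n%n≡0 m 2))
  where
  m+m≡m*2 : m + m ≡ m * 2
  m+m≡m*2 = trans (cong (_+_ m) (sym (+-identityʳ m))) (*-comm 2 m)

sumBelow-cong₂ : ∀ n {f g : ℕ → ℕ} → (∀ k → k < n → f k ≡₂ g k) → sumBelow n f ≡₂ sumBelow n g
sumBelow-cong₂ zero    f≡₂g = ≡₂-refl
sumBelow-cong₂ (suc n) f≡₂g =
  ≡₂-+ (f≡₂g 0 (s≤s z≤n)) (sumBelow-cong₂ n (λ k k<n → f≡₂g (suc k) (s≤s k<n)))

sumBelow-≡₂-0 : ∀ n {f : ℕ → ℕ} → (∀ k → k < n → f k ≡₂ 0) → sumBelow n f ≡₂ 0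
sumBelow-≡₂-0 zero    f≡₂0 = ≡₂-refl
sumBelow-≡₂-0 (suc n) f≡₂0 =
  ≡₂-+ (f≡₂0 0 (s≤s z≤n)) (sumBelow-≡₂-0 n (λ k k<n → f≡₂0 (suc k) (s≤s k<n)))

sumBelow-≡₂-single : ∀ {n j} (f : ℕ → ℕ) → j < n → (∀ k → k < n → k ≢ j → f k ≡₂ 0) →
  sumBelow n f ≡₂ f j
sumBelow-≡₂-single {suc n} {zero}  f _ f≡₂0 =
  ≡₂-trans (≡₂-+ ≡₂-refl (sumBelow-≡₂-0 n (λ k k<n → f≡₂0 (suc k) (s≤s k<n) λ ())))
           (≡⇒≡₂ (+-identityʳ (f 0)))
sumBelow-≡₂-single {suc n} {suc j} f (s≤s j<n) f≡₂0 =
  ≡₂-+ (f≡₂0 0 (s≤s z≤n) λ ())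
       (sumBelow-≡₂-single (f ∘ suc) j<n (λ k k<n k≢j → f≡₂0 (suc k) (s≤s k<n) (k≢j ∘ suc-injective)))

-- The off-diagonal entries of a symmetric matrix come in equal pairs.
sumBelow²-≡₂-diagonal : ∀ n (f : ℕ → ℕ → ℕ) → (∀ a b → f a b ≡ f b a) →
  sumBelow n (λ a → sumBelow n (f a)) ≡₂ sumBelow n (λ a → f a a)
sumBelow²-≡₂-diagonal zero    f f-sym = ≡₂-refl
sumBelow²-≡₂-diagonal (suc n) f f-sym = begin
    (f 0 0 + row) + sumBelow n (λ a → f (suc a) 0 + sumBelow n (f (suc a) ∘ suc))
  ≡⟨ cong (_+_ (f 0 0 + row)) (sumBelow-+ n (λ a → f (suc a) 0) _) ⟩
    (f 0 0 + row) + (column + inner)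
  ≡⟨ trans (+-assoc (f 0 0) row _) (cong (_+_ (f 0 0)) (sym (+-assoc row column inner))) ⟩
    f 0 0 + ((row + column) + inner)
  ≈⟨ ≡₂-+ ≡₂-refl (≡₂-+ row+column≡₂0 inner≡₂diagonal) ⟩
    f 0 0 + sumBelow n (λ a → f (suc a) (suc a))
  ∎
  where
  open SetoidReasoning ≡₂-setoid
  row column inner : ℕ
  row    = sumBelow n (f 0 ∘ suc)
  column = sumBelow n (λ a → f (suc a) 0)
  inner  = sumBelow n (λ a → sumBelow n (f (suc a) ∘ suc))
  row+column≡₂0 : row + column ≡₂ 0
  row+column≡₂0 = ≡₂-trans (≡⇒≡₂ (cong (_+_ row) (sumBelow-cong n (λ a → f-sym (suc a) 0)))) (m+m≡₂0 row)
  inner≡₂diagonal : inner ≡₂ sumBelow n (λ a → f (suc a) (suc a))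
  inner≡₂diagonal = sumBelow²-≡₂-diagonal n (λ a b → f (suc a) (suc b)) (λ a b → f-sym (suc a) (suc b))

indicator : {P : Set} → Dec P → ℕ
indicator (true  because _) = 1
indicator (false because _) = 0

indicator-cong : {P Q : Set} → P ⇔ Q → (p? : Dec P) (q? : Dec Q) → indicator p? ≡ indicator q?
indicator-cong P⇔Q (yes _) (yes _) = refl
indicator-cong P⇔Q (yes p) (no ¬q) = contradiction (Equivalence.to P⇔Q p) ¬q
indicator-cong P⇔Q (no ¬p) (yes q) = contradiction (Equivalence.from P⇔Q q) ¬p
indicator-cong P⇔Q (no _)  (no _)  = refl

indicator-yes : {P : Set} → P → (p? : Dec P) → indicator p? ≡ 1
indicator-yes p (yes _) = refl
indicator-yes p (no ¬p) = contradiction p ¬p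

indicator-no : {P : Set} → ¬ P → (p? : Dec P) → indicator p? ≡ 0
indicator-no ¬p (yes p) = contradiction p ¬p
indicator-no ¬p (no _)  = refl

indicator-×-split : {P E O : Set} (p? : Dec P) (e? : Dec E) (o? : Dec O) → E ⊎ O → ¬ (E × O) →
  indicator (p? ×-dec e?) + indicator (p? ×-dec o?) ≡ indicator p?
indicator-×-split (no _)  _       _       _          _      = refl
indicator-×-split (yes _) (yes e) (yes o) _          ¬e×o   = contradiction (e , o) ¬e×o
indicator-×-split (yes _) (yes _) (no _)  _          _      = refl
indicator-×-split (yes _) (no _)  (yes _) _          _      = refl
indicator-×-split (yes _) (no ¬e) (no _)  (inj₁ e)   _      = contradiction e ¬e
indicator-×-split (yes _) (no _)  (no ¬o) (inj₂ o)   _      = contradiction o ¬o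

indicator-≟-+ : ∀ j {t u} → indicator (t ≟ u) ≡ indicator (j + t ≟ j + u)
indicator-≟-+ j = indicator-cong (mk⇔ (cong (_+_ j)) (+-cancelˡ-≡ j _ _)) _ _

length-filter-filter : ∀ {A : Set} {P Q : A → Set} (P? : ∀ x → Dec (P x)) (Q? : ∀ x → Dec (Q x)) xs →
  length (filter Q? (filter P? xs)) ≡ sum (map (λ x → indicator (P? x ×-dec Q? x)) xs)
length-filter-filter P? Q? []       = refl
length-filter-filter P? Q? (x ∷ xs) with P? x
... | no _  = length-filter-filter P? Q? xs
... | yes _ with Q? x
...   | no _  = length-filter-filter P? Q? xs
...   | yes _ = cong suc (length-filter-filter P? Q? xs)

IsOverpartition-rebarHead : ∀ {s a b b′ r} →
  IsOverpartition s ((a , b) ∷ r) → IsOverpartition s ((a , b′) ∷ r)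
IsOverpartition-rebarHead (a>0 ∷ r>0 , [-]       , sum≡s) = a>0 ∷ r>0 , [-]       , sum≡s
IsOverpartition-rebarHead (a>0 ∷ r>0 , adj ∷ lnk , sum≡s) = a>0 ∷ r>0 , adj ∷ lnk , sum≡s

IsOverpartition-rebarHead⇔ : ∀ {s a b b′ r} →
  IsOverpartition s ((a , b) ∷ r) ⇔ IsOverpartition s ((a , b′) ∷ r)
IsOverpartition-rebarHead⇔ = mk⇔ IsOverpartition-rebarHead IsOverpartition-rebarHead

IsOverpartition-head≤ : ∀ {s p r} → IsOverpartition s (p ∷ r) → proj₁ p ≤ s
IsOverpartition-head≤ {p = p} (_ , _ , sum≡s) = subst (proj₁ p ≤_) sum≡s (m≤m+n (proj₁ p) _)

IsOverpartition-[-]⇔ : ∀ {s j b} → 1 ≤ j → IsOverpartition s ((j , b) ∷ []) ⇔ s ≡ j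
IsOverpartition-[-]⇔ {j = j} j>0 = mk⇔
  (λ (_ , _ , j+0≡s) → trans (sym j+0≡s) (+-identityʳ j))
  (λ s≡j → j>0 ∷ [] , [-] , trans (+-identityʳ j) (sym s≡j))

IsOverpartition-∷⇔ : ∀ {j b t q r} → 1 ≤ j →
  IsOverpartition (j + t) ((j , b) ∷ q ∷ r) ⇔ (Adjacent (j , b) q × IsOverpartition t (q ∷ r))
IsOverpartition-∷⇔ {j} j>0 = mk⇔
  (λ { (_ ∷ rest>0 , adj ∷ lnk , sum≡j+t) → adj , rest>0 , lnk , +-cancelˡ-≡ j _ _ sum≡j+t })
  (λ (adj , rest>0 , lnk , sum≡t) → j>0 ∷ rest>0 , adj ∷ lnk , cong (_+_ j) sum≡t)

sum-listsOfLength-suc : ∀ (f : List Part → ℕ) B m →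
  sum (map f (listsOfLength B (suc m))) ≡
  sumBelow B (λ k → sum (map (λ r → f ((suc k , true) ∷ r)) (listsOfLength B m))
                  + sum (map (λ r → f ((suc k , false) ∷ r)) (listsOfLength B m)))
sum-listsOfLength-suc f B m =
  trans (sum-map-concatMap f _ (applyUpTo id B))
  (trans (sum-map-applyUpTo _ id B)
         (sumBelow-cong B λ k →
           trans (sum-map-concatMap f (λ b → map ((suc k , b) ∷_) (listsOfLength B m)) (true ∷ false ∷ []))
                 (cong₂ _+_ (sum-map-map k true) (trans (+-identityʳ _) (sum-map-map k false)))))
  where
  sum-map-map : ∀ k b → sum (map f (map ((suc k , b) ∷_) (listsOfLength B m)))
                      ≡ sum (map (λ r → f ((suc k , b) ∷ r)) (listsOfLength B m))
  sum-map-map k b = cong sum (sym (map-∘ (listsOfLength B m)))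

unbarredSum : (List Part → ℕ) → ℕ → ℕ
unbarredSum f n =
  sumBelow n (λ m → sumBelow n (λ k → sum (map (λ r → f ((suc k , false) ∷ r)) (listsOfLength n m))))

sum-candidates-halve : ∀ (f : List Part → ℕ) n → f [] ≡ 0 →
  (∀ a r → f ((a , true) ∷ r) ≡ f ((a , false) ∷ r)) →
  sum (map f (candidates n)) ≡ unbarredSum f n + unbarredSum f n
sum-candidates-halve f n f[]≡0 f-rebar = begin
    sum (map f (candidates n))
  ≡⟨ trans (sum-map-concatMap f (listsOfLength n) (applyUpTo id (suc n)))
           (sum-map-applyUpTo _ id (suc n)) ⟩
    (f [] + 0) + sumBelow n (λ m → sum (map f (listsOfLength n (suc m))))
  ≡⟨ cong₂ _+_ (cong (_+ 0) f[]≡0) (sumBelow-cong n λ m →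
       trans (sum-listsOfLength-suc f n m)
             (sumBelow-cong n λ k → cong (_+ unbarred k m) (sum-map-cong (f-rebar (suc k)) (listsOfLength n m)))) ⟩
    sumBelow n (λ m → sumBelow n (λ k → unbarred k m + unbarred k m))
  ≡⟨ sumBelow-cong n (λ m → sumBelow-+ n (λ k → unbarred k m) (λ k → unbarred k m)) ⟩
    sumBelow n (λ m → sumBelow n (λ k → unbarred k m) + sumBelow n (λ k → unbarred k m))
  ≡⟨ sumBelow-+ n _ _ ⟩
    unbarredSum f n + unbarredSum f n
  ∎
  where
  open ≡-Reasoning
  unbarred : ℕ → ℕ → ℕ
  unbarred k m = sum (map (λ r → f ((suc k , false) ∷ r)) (listsOfLength n m))

overpartitionIndicator : ℕ → List Part → ℕ
overpartitionIndicator s xs = indicator (isOverpartition? s xs)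

headCount : ℕ → ℕ → ℕ → ℕ → ℕ
headCount B j s m = sum (map (λ r → overpartitionIndicator s ((j , false) ∷ r)) (listsOfLength B m))

headCount-below : ∀ B {j s} m → s < j → headCount B j s m ≡ 0
headCount-below B m s<j =
  sum-map-zero (λ r → indicator-no (<⇒≱ s<j ∘ IsOverpartition-head≤) _) (listsOfLength B m)

headCount-single : ∀ B {j′} s → headCount B (suc j′) s 0 ≡ indicator (s ≟ suc j′)
headCount-single B s = trans (+-identityʳ _) (indicator-cong (IsOverpartition-[-]⇔ (s≤s z≤n)) _ _)

headCount-removeLargest : ∀ {B j′} t m → j′ < B →
  headCount B (suc j′) (suc j′ + t) (suc m) ≡₂ headCount B (suc j′) t m
headCount-removeLargest {B} {j′} t m j′<B = begin
    headCount B j (j + t) (suc m)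
  ≡⟨ sum-listsOfLength-suc (λ r → overpartitionIndicator (j + t) ((j , false) ∷ r)) B m ⟩
    sumBelow B (λ k → next k true + next k false)
  ≈⟨ sumBelow-≡₂-single (λ k → next k true + next k false) j′<B pair≡₂0 ⟩
    next j′ true + next j′ false
  ≡⟨ cong₂ _+_ (next-nonadjacent j′ true j,true-nonadjacent) (next-adjacent j′ false (inj₂ (refl , refl))) ⟩
    headCount B j t m
  ∎
  where
  open SetoidReasoning ≡₂-setoid
  j : ℕ
  j = suc j′
  next rest : ℕ → Bool → ℕ
  next k b = sum (map (λ r → overpartitionIndicator (j + t) ((j , false) ∷ (suc k , b) ∷ r)) (listsOfLength B m))
  rest k b = sum (map (λ r → overpartitionIndicator t ((suc k , b) ∷ r)) (listsOfLength B m))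

  next-adjacent : ∀ k b → Adjacent (j , false) (suc k , b) → next k b ≡ rest k b
  next-adjacent k b adj = sum-map-cong
    (λ r → indicator-cong (mk⇔ (proj₂ ∘ Equivalence.to (IsOverpartition-∷⇔ (s≤s z≤n)))
                               (λ op → Equivalence.from (IsOverpartition-∷⇔ (s≤s z≤n)) (adj , op))) _ _)
    (listsOfLength B m)

  next-nonadjacent : ∀ k b → ¬ Adjacent (j , false) (suc k , b) → next k b ≡ 0
  next-nonadjacent k b ¬adj = sum-map-zero
    (λ r → indicator-no (¬adj ∘ proj₁ ∘ Equivalence.to (IsOverpartition-∷⇔ (s≤s z≤n))) _)
    (listsOfLength B m)

  j,true-nonadjacent : ¬ Adjacent (j , false) (j , true)
  j,true-nonadjacent (inj₁ j<j)     = <-irrefl refl j<j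
  j,true-nonadjacent (inj₂ (_ , ()))

  pair≡₂0 : ∀ k → k < B → k ≢ j′ → next k true + next k false ≡₂ 0
  pair≡₂0 k _ k≢j′ with <-cmp k j′
  ... | tri< k<j′ _ _ = begin
      next k true + next k false
    ≡⟨ cong₂ _+_ (next-adjacent k true (inj₁ (s≤s k<j′))) (next-adjacent k false (inj₁ (s≤s k<j′))) ⟩
      rest k true + rest k false
    ≡⟨ cong (_+ rest k false) (sum-map-cong (λ r → indicator-cong IsOverpartition-rebarHead⇔ _ _) (listsOfLength B m)) ⟩
      rest k false + rest k false
    ≈⟨ m+m≡₂0 (rest k false) ⟩
      0
    ∎
  ... | tri≈ _ k≡j′ _ = contradiction k≡j′ k≢j′
  ... | tri> _ _ j′<k = ≡⇒≡₂ (cong₂ _+_ (next-nonadjacent k true (j′<k-nonadjacent true))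
                                          (next-nonadjacent k false (j′<k-nonadjacent false)))
    where
    j′<k-nonadjacent : ∀ b → ¬ Adjacent (j , false) (suc k , b)
    j′<k-nonadjacent b (inj₁ (s≤s k<j′))  = <-asym j′<k k<j′
    j′<k-nonadjacent b (inj₂ (1+k≡j , _)) = <-irrefl (sym (suc-injective 1+k≡j)) j′<k

headCount-≡₂ : ∀ {B j′} → j′ < B → ∀ m s → headCount B (suc j′) s m ≡₂ indicator (s ≟ suc j′ * suc m)
headCount-≡₂ {B} {j′} j′<B zero s = ≡⇒≡₂ (begin
  headCount B (suc j′) s 0       ≡⟨ headCount-single B s ⟩
  indicator (s ≟ suc j′)         ≡⟨ cong (λ x → indicator (s ≟ x)) (*-identityʳ (suc j′)) ⟨
  indicator (s ≟ suc j′ * 1)     ∎)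
  where open ≡-Reasoning
headCount-≡₂ {B} {j′} j′<B (suc m) s with s <? suc j′
... | yes s<j = ≡⇒≡₂ (trans (headCount-below B (suc m) s<j) (sym (indicator-no s≢j[m+2] _)))
  where
  s≢j[m+2] : s ≢ suc j′ * suc (suc m)
  s≢j[m+2] s≡j[m+2] = <⇒≱ s<j (subst (suc j′ ≤_) (sym s≡j[m+2]) (m≤m*n (suc j′) (suc (suc m))))
... | no s≮j with t , refl ← m≤n⇒∃[o]m+o≡n (≮⇒≥ s≮j) = begin
    headCount B (suc j′) (suc j′ + t) (suc m)
  ≈⟨ headCount-removeLargest t m j′<B ⟩
    headCount B (suc j′) t m
  ≈⟨ headCount-≡₂ j′<B m t ⟩
    indicator (t ≟ suc j′ * suc m)
  ≡⟨ indicator-≟-+ (suc j′) ⟩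
    indicator (suc j′ + t ≟ suc j′ + suc j′ * suc m)
  ≡⟨ cong (λ x → indicator (suc j′ + t ≟ x)) (*-suc (suc j′) (suc m)) ⟨
    indicator (suc j′ + t ≟ suc j′ * suc (suc m))
  ∎
  where open SetoidReasoning ≡₂-setoid

*-self-injective : ∀ {a b} → a * a ≡ b * b → a ≡ b
*-self-injective {a} {b} a²≡b² with <-cmp a b
... | tri< a<b _ _ = contradiction a²≡b² (<⇒≢ (*-mono-< a<b a<b))
... | tri≈ _ a≡b _ = a≡b
... | tri> _ _ b<a = contradiction (sym a²≡b²) (<⇒≢ (*-mono-< b<a b<a))

squareCount : ℕ → ℕ
squareCount n = sumBelow n (λ a → indicator (n ≟ suc a * suc a))

squareCount-nonsquare : ∀ n → ¬ IsSquare n → squareCount n ≡₂ 0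
squareCount-nonsquare n ¬square =
  sumBelow-≡₂-0 n (λ a _ → ≡⇒≡₂ (indicator-no (λ n≡a² → ¬square (suc a , sym n≡a²)) _))

squareCount-square : ∀ {n} → 1 ≤ n → IsSquare n → squareCount n ≡₂ 1
squareCount-square 1≤n (zero  , refl) = contradiction 1≤n λ ()
squareCount-square _   (suc a , refl) = ≡₂-trans
  (sumBelow-≡₂-single (λ k → indicator (suc a * suc a ≟ suc k * suc k)) (m≤m*n (suc a) (suc a))
    (λ k _ k≢a → ≡⇒≡₂ (indicator-no (λ a²≡k² → k≢a (suc-injective (*-self-injective (sym a²≡k²)))) _)))
  (≡⇒≡₂ (indicator-yes refl _))

overpartitionCount : ℕ → ℕ
overpartitionCount n = sum (map (overpartitionIndicator n) (candidates n))

unbarredOverpartitions-≡₂-squareCount : ∀ n → unbarredSum (overpartitionIndicator n) n ≡₂ squareCount n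
unbarredOverpartitions-≡₂-squareCount n = begin
    sumBelow n (λ m → sumBelow n (λ k → headCount n (suc k) n m))
  ≈⟨ sumBelow-cong₂ n (λ m _ → sumBelow-cong₂ n (λ k k<n → headCount-≡₂ k<n m n)) ⟩
    sumBelow n (λ m → sumBelow n (λ k → indicator (n ≟ suc k * suc m)))
  ≈⟨ sumBelow²-≡₂-diagonal n (λ m k → indicator (n ≟ suc k * suc m))
       (λ m k → cong (λ x → indicator (n ≟ x)) (*-comm (suc k) (suc m))) ⟩
    squareCount n
  ∎
  where open SetoidReasoning ≡₂-setoid

%2≡0⊎%2≡1 : ∀ m → m % 2 ≡ 0 ⊎ m % 2 ≡ 1
%2≡0⊎%2≡1 m with m % 2 | m%n<n m 2
... | 0 | _ = inj₁ refl
... | 1 | _ = inj₂ refl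
... | suc (suc _) | s≤s (s≤s ())

Me+Mo≡overpartitionCount : ∀ n → Me n + Mo n ≡ overpartitionCount n
Me+Mo≡overpartitionCount n = begin
    Me n + Mo n
  ≡⟨ cong₂ _+_ (length-filter-filter (isOverpartition? n) even? (candidates n))
               (length-filter-filter (isOverpartition? n) odd? (candidates n)) ⟩
    sum (map evenIndicator (candidates n)) + sum (map oddIndicator (candidates n))
  ≡⟨ sum-map-+ evenIndicator oddIndicator (candidates n) ⟨
    sum (map (λ xs → evenIndicator xs + oddIndicator xs) (candidates n))
  ≡⟨ sum-map-cong (λ xs → indicator-×-split (isOverpartition? n xs) (even? xs) (odd? xs)
                            (%2≡0⊎%2≡1 (numMissing xs)) (λ (e , o) → 0≢1+n (trans (sym e) o)))
                  (candidates n) ⟩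
    overpartitionCount n
  ∎
  where
  open ≡-Reasoning
  even? : ∀ xs → Dec (numMissing xs % 2 ≡ 0)
  even? xs = numMissing xs % 2 ≟ 0
  odd? : ∀ xs → Dec (numMissing xs % 2 ≡ 1)
  odd? xs = numMissing xs % 2 ≟ 1
  evenIndicator oddIndicator : List Part → ℕ
  evenIndicator xs = indicator (isOverpartition? n xs ×-dec even? xs)
  oddIndicator  xs = indicator (isOverpartition? n xs ×-dec odd? xs)

overpartitionCount-halve : ∀ {n} → 1 ≤ n →
  overpartitionCount n ≡ unbarredSum (overpartitionIndicator n) n + unbarredSum (overpartitionIndicator n) n
overpartitionCount-halve {n} 1≤n = sum-candidates-halve (overpartitionIndicator n) n
  (indicator-no (λ (_ , _ , 0≡n) → <⇒≢ 1≤n 0≡n) _)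
  (λ a r → indicator-cong IsOverpartition-rebarHead⇔ _ _)

Mo-even : ∀ {n} → 1 ≤ n → ∃ λ o → Mo n ≡ o + o
Mo-even {n} 1≤n = unbarredSum oddIndicator n ,
  trans (length-filter-filter (isOverpartition? n) (λ xs → numMissing xs % 2 ≟ 1) (candidates n))
        (sum-candidates-halve oddIndicator n
          (indicator-no (λ ((_ , _ , 0≡n) , _) → <⇒≢ 1≤n 0≡n) _)
          -- numMissing only sees the sizes of the parts, so it is unchanged by rebarring.
          (λ a r → indicator-cong (mk⇔ (map₁ IsOverpartition-rebarHead) (map₁ IsOverpartition-rebarHead)) _ _))
  where
  oddIndicator : List Part → ℕ
  oddIndicator xs = indicator (isOverpartition? n xs ×-dec (numMissing xs % 2 ≟ 1))

≡₂-decompose : ∀ {u c} → u ≡₂ c → c < 2 → u ≡ c + (u / 2) * 2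
≡₂-decompose {u} {c} (mod₂ u≡₂c) c<2 =
  trans (m≡m%n+[m/n]*n u 2) (cong (_+ (u / 2) * 2) (trans u≡₂c (m<n⇒m%n≡m c<2)))

4∣difference : ∀ {me mo u} o c t → me + mo ≡ u + u → mo ≡ o + o → u ≡ c + t * 2 →
  + 4 ∣ (+ me - + mo) - + (c + c)
4∣difference {me} o c t me+mo≡u+u refl refl =
  subst (+ 4 ∣_) (sym difference≡4[t-o]) (ℤ∣.*-monoʳ-∣ (+ 4) {+ 1} {T ℤ.- O} (ℕ∣.1∣ _))
  where
  open ≡-Reasoning
  M O C T U : ℤ
  M = + me
  O = + o
  C = + c
  T = + t
  U = C ℤ.+ T ℤ.* + 2

  expansion : ∀ M O C T →
    (M ℤ.- (O ℤ.+ O)) ℤ.- (C ℤ.+ C)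
      ≡ + 4 ℤ.* (T ℤ.- O) ℤ.+ ((M ℤ.+ (O ℤ.+ O)) ℤ.- ((C ℤ.+ T ℤ.* + 2) ℤ.+ (C ℤ.+ T ℤ.* + 2)))
  expansion = solve-∀

  +u≡U : + (c + t * 2) ≡ U
  +u≡U = trans (ℤ.pos-+ c (t * 2)) (cong (ℤ._+_ C) (ℤ.pos-* t 2))

  M+2O≡2U : M ℤ.+ (O ℤ.+ O) ≡ U ℤ.+ U
  M+2O≡2U = begin
    M ℤ.+ (O ℤ.+ O)                  ≡⟨ cong (ℤ._+_ M) (ℤ.pos-+ o o) ⟨
    M ℤ.+ + (o + o)                  ≡⟨ ℤ.pos-+ me (o + o) ⟨
    + (me + (o + o))                 ≡⟨ cong +_ me+mo≡u+u ⟩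
    + ((c + t * 2) + (c + t * 2))    ≡⟨ ℤ.pos-+ (c + t * 2) (c + t * 2) ⟩
    + (c + t * 2) ℤ.+ + (c + t * 2)  ≡⟨ cong₂ ℤ._+_ +u≡U +u≡U ⟩
    U ℤ.+ U                          ∎

  difference≡4[t-o] : (M - + (o + o)) - + (c + c) ≡ + 4 ℤ.* (T ℤ.- O)
  difference≡4[t-o] = begin
      (M - + (o + o)) - + (c + c)
    ≡⟨ cong₂ (λ x y → (M ℤ.- x) ℤ.- y) (ℤ.pos-+ o o) (ℤ.pos-+ c c) ⟩
      (M ℤ.- (O ℤ.+ O)) ℤ.- (C ℤ.+ C)
    ≡⟨ expansion M O C T ⟩
      + 4 ℤ.* (T ℤ.- O) ℤ.+ ((M ℤ.+ (O ℤ.+ O)) ℤ.- (U ℤ.+ U))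
    ≡⟨ cong (ℤ._+_ (+ 4 ℤ.* (T ℤ.- O))) (trans (cong (ℤ._- (U ℤ.+ U)) M+2O≡2U) (ℤ.+-inverseʳ (U ℤ.+ U))) ⟩
      + 4 ℤ.* (T ℤ.- O) ℤ.+ + 0
    ≡⟨ ℤ.+-identityʳ _ ⟩
      + 4 ℤ.* (T ℤ.- O)
    ∎

theorem3p7 : (n : ℕ) → 1 ≤ n →
    ((¬ IsSquare n → + 4 ∣ ((+ Me n - + Mo n) - + 0))
     × (IsSquare n → + 4 ∣ ((+ Me n - + Mo n) - + 2)))
theorem3p7 n 1≤n =
    (λ ¬square → congruence (squareCount-nonsquare n ¬square) (s≤s z≤n))
  , (λ square → congruence (squareCount-square 1≤n square) (s≤s (s≤s z≤n)))
  where
  u : ℕ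
  u = unbarredSum (overpartitionIndicator n) n
  congruence : ∀ {c} → squareCount n ≡₂ c → c < 2 → + 4 ∣ (+ Me n - + Mo n) - + (c + c)
  congruence {c} squareCount≡₂c c<2 =
    let o , Mo≡o+o = Mo-even 1≤n in
    4∣difference o c (u / 2)
      (trans (Me+Mo≡overpartitionCount n) (overpartitionCount-halve 1≤n))
      Mo≡o+o
      (≡₂-decompose (≡₂-trans (unbarredOverpartitions-≡₂-squareCount n) squareCount≡₂c) c<2)
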